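{- Let $r\geq3$, let $D$ be an $m$-colored semicomplete $r$-partite digraph such that every directed $4$-cycle contained in $D$ is at most $2$-colored, and let $x,y\in V(D)$. If there exists a $3$-colored directed path from $x$ to $y$ and there does not exist a $k'$-colored directed path from $y$ to $x$ with $k'\leq 3$, then $d(x,y)\leq 2$.
   Context: A digraph is $m$-colored if each arc is assigned one of $m$ colors. A semicomplete $r$-partite digraph is obtained from a complete $r$-partite graph by replacing each edge $uv$ by the arc $(u,v)$, the arc $(v,u)$, or both; no arcs join vertices of the same part. A directed path is $j$-colored if its arcs use exactly $j$ distinct colors; a subdigraph is at most $2$-colored if its arcs use at most $2$ colors. $d(x,y)$ denotes the minimum number of arcs of a directed path from $x$ to $y$. -}

module Defs where

open import Data.Nat using (ℕ; zero; suc; _≤_)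
open import Data.Fin using (Fin)
open import Data.Fin.Properties using (_≟_)
open import Data.Bool using (Bool; T)
open import Data.List using (List; []; _∷_; length; deduplicate)
open import Data.List.Relation.Unary.Unique.Propositional using (Unique)
open import Data.Product using (_×_; Σ; ∃; _,_)
open import Data.Sum using (_⊎_)
open import Relation.Nullary using (¬_)
open import Relation.Binary.PropositionalEquality using (_≡_; _≢_)
open import Function using (Surjective)

-- An m-colored digraph on the vertex set Fin n:
--  arc u v = true  iff (u,v) is an arc;
--  colour u v is the colour of the arc (u,v) (irrelevant for non-arcs).
record ColoredDigraph (n m : ℕ) : Set where
  field
    arc    : Fin n → Fin n → Bool
    colour : Fin n → Fin n → Fin m

module _ {n m : ℕ} (D : ColoredDigraph n m) where
  open ColoredDigraph D

  Arc : Fin n → Fin n → Set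
  Arc u v = T (arc u v)

  data Walk : Fin n → Fin n → Set where
    []  : ∀ {x} → Walk x x
    _∷_ : ∀ {x y z} → Arc x y → Walk y z → Walk x z

  vertices : ∀ {x y} → Walk x y → List (Fin n)
  vertices {x} []      = x ∷ []
  vertices {x} (_ ∷ w) = x ∷ vertices w

  len : ∀ {x y} → Walk x y → ℕ
  len []      = zero
  len (_ ∷ w) = suc (len w)

  arcColours : ∀ {x y} → Walk x y → List (Fin m)
  arcColours []            = []
  arcColours {x} (_∷_ {y = y} _ w) = colour x y ∷ arcColours w

  numColours : ∀ {x y} → Walk x y → ℕ
  numColours w = length (deduplicate _≟_ (arcColours w))

  IsPath : ∀ {x y} → Walk x y → Set
  IsPath w = Unique (vertices w)

  HasColoredPath : ℕ → Fin n → Fin n → Set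
  HasColoredPath j x y = Σ (Walk x y) λ w → IsPath w × numColours w ≡ j

  -- d(x,y) ≤ k : there is a directed path from x to y with at most k arcs
  DistLe : Fin n → Fin n → ℕ → Set
  DistLe x y k = Σ (Walk x y) λ w → IsPath w × len w ≤ k

  FourCyclesAtMost2Colored : Set
  FourCyclesAtMost2Colored =
    ∀ (a b c d : Fin n) →
    Unique (a ∷ b ∷ c ∷ d ∷ []) →
    Arc a b → Arc b c → Arc c d → Arc d a →
    length (deduplicate _≟_ (colour a b ∷ colour b c ∷ colour c d ∷ colour d a ∷ [])) ≤ 2

  -- D is a semicomplete r-partite digraph with partition given by `part`
  -- (each of the r parts nonempty, as in a complete r-partite graph).
  IsSemicompleteMultipartite : (r : ℕ) → (Fin n → Fin r) → Set
  IsSemicompleteMultipartite r part =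
    Surjective _≡_ _≡_ part ×
    (∀ u v → part u ≡ part v → ¬ Arc u v) ×
    (∀ u v → part u ≢ part v → Arc u v ⊎ Arc v u)

module Submission where

-- Let x ≠ y (otherwise the trivial path y → x has 0 colours).
-- If x and y lie in different parts they are adjacent, and the arc cannot be
-- y → x (a 1-coloured return path), so d(x,y) = 1.  If they lie in the same
-- part and there is no x → z → y, we show that no directed walk from x to y
-- exists at all, contradicting the hypothesis.  Call u *dominated* if x → u
-- and y → u.  Every out-neighbour of x is dominated, and along any walk to y
-- we can always move on to a further dominated vertex: an out-neighbour v of
-- a dominated u outside the part of x is itself dominated, and if v is inside
-- that part, then the next vertex a after v is dominated.  Every alternative
-- produces a return path y ⇝ x with at most 3 colours: of length ≤ 3 directly,
-- or y → u → v → a → x, whose last three arcs lie on the 4-cycle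
-- x → u → v → a → x and so (by the 4-cycle hypothesis) use at most 2 colours.
-- Since a dominated vertex is never y, the walk can never reach y.

open import Defs
open import Data.Nat using (ℕ; _≤_; suc; z≤n; s≤s)
open import Data.Nat.Properties using (≤-trans; ≤-reflexive)
open import Data.Fin using (Fin)
import Data.Fin.Properties as Fin
open import Data.Product using (Σ; _×_; _,_; proj₁)
open import Data.Sum using (_⊎_; inj₁; inj₂)
open import Data.Empty using (⊥; ⊥-elim)
open import Data.Bool.Properties using (T?)
open import Data.List using (List; []; _∷_; length; filter; deduplicate)
open import Data.List.Properties using (length-filter; filter-all)
open import Data.List.Relation.Unary.All using ([]; _∷_)
open import Data.List.Relation.Unary.AllPairs using ([]; _∷_)
open import Data.List.Relation.Unary.Unique.Propositional using (Unique)
open import Data.List.Relation.Unary.Unique.DecPropositional.Properties using (deduplicate-!)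
open import Relation.Nullary using (¬_; yes; no; _×-dec_; ¬?)
open import Relation.Binary.Definitions using (DecidableEquality)
open import Relation.Binary.PropositionalEquality using (_≡_; _≢_; refl; sym; trans; cong)

module DistinctCount {A : Set} (_≟_ : DecidableEquality A) where

  distinct : List A → ℕ
  distinct l = length (deduplicate _≟_ l)

  distinct≤length : ∀ l → distinct l ≤ length l
  distinct≤length []      = z≤n
  distinct≤length (c ∷ l) =
    s≤s (≤-trans (length-filter (λ z → ¬? (c ≟ z)) (deduplicate _≟_ l)) (distinct≤length l))

  unique-filter-≢ : ∀ c ys → Unique ys →
                    length ys ≤ suc (length (filter (λ z → ¬? (c ≟ z)) ys))
  unique-filter-≢ c []       _          = z≤n
  unique-filter-≢ c (y ∷ ys) (c∉ys ∷ u) with c ≟ y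
  ... | yes refl = s≤s (≤-reflexive (sym (cong length (filter-all (λ z → ¬? (c ≟ z)) c∉ys))))
  ... | no _     = s≤s (unique-filter-≢ c ys u)

  distinct-cons-≤ : ∀ c l → distinct (c ∷ l) ≤ suc (distinct l)
  distinct-cons-≤ c l = s≤s (length-filter (λ z → ¬? (c ≟ z)) (deduplicate _≟_ l))

  distinct-cons-≥ : ∀ c l → distinct l ≤ distinct (c ∷ l)
  distinct-cons-≥ c l = unique-filter-≢ c (deduplicate _≟_ l) (deduplicate-! _≟_ l)

  distinct-replaceHead : ∀ c c′ l → distinct (c ∷ l) ≤ suc (distinct (c′ ∷ l))
  distinct-replaceHead c c′ l =
    ≤-trans (distinct-cons-≤ c l) (s≤s (distinct-cons-≥ c′ l))

open DistinctCount using (distinct≤length; distinct-replaceHead)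

module _ {n m : ℕ} (D : ColoredDigraph n m) where

  hop : ∀ {a} b {c} → Arc D a b → Walk D b c → Walk D a c
  hop b e w = _∷_ {y = b} e w

  length-arcColours : ∀ {x y} (w : Walk D x y) → length (arcColours D w) ≡ len D w
  length-arcColours []      = refl
  length-arcColours (_ ∷ w) = cong suc (length-arcColours w)

  numColours≤len : ∀ {x y} (w : Walk D x y) → numColours D w ≤ len D w
  numColours≤len w = ≤-trans (distinct≤length Fin._≟_ (arcColours D w))
                             (≤-reflexive (length-arcColours w))

module Argument {n m r : ℕ} (D : ColoredDigraph n m) (part : Fin n → Fin r)
  (noSamePart : ∀ u v → part u ≡ part v → ¬ Arc D u v)
  (adjacent : ∀ u v → part u ≢ part v → Arc D u v ⊎ Arc D v u)
  (fourCycles : FourCyclesAtMost2Colored D)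
  (x y : Fin n) (x≢y : x ≢ y)
  (noReturn : ¬ (Σ ℕ λ k′ → k′ ≤ 3 × HasColoredPath D k′ y x)) where

  open ColoredDigraph D

  arcPart : ∀ {u v} → Arc D u v → part u ≢ part v
  arcPart {u} {v} e eq = noSamePart u v eq e

  arcNe : ∀ {u v} → Arc D u v → u ≢ v
  arcNe e refl = arcPart e refl

  y≢x : y ≢ x
  y≢x eq = x≢y (sym eq)

  -- A return path with at most 3 arcs has at most 3 colours, so none exists.
  noShortReturn : (w : Walk D y x) → IsPath D w → len D w ≤ 3 → ⊥
  noShortReturn w isPath short =
    noReturn (_ , ≤-trans (numColours≤len D w) short , w , isPath , refl)

  noReturn1 : ¬ Arc D y x
  noReturn1 yx = noShortReturn (hop D x yx []) ((y≢x ∷ []) ∷ [] ∷ []) (s≤s z≤n)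

  noReturn2 : ∀ {u} → Arc D y u → Arc D u x → ⊥
  noReturn2 {u} yu ux = noShortReturn (hop D u yu (hop D x ux []))
    ((arcNe yu ∷ y≢x ∷ []) ∷ (arcNe ux ∷ []) ∷ [] ∷ []) (s≤s (s≤s z≤n))

  noReturn3 : ∀ {u v} → Arc D y u → Arc D u v → Arc D v x → y ≢ v → u ≢ x → ⊥
  noReturn3 {u} {v} yu uv vx y≢v u≢x = noShortReturn (hop D u yu (hop D v uv (hop D x vx [])))
    ((arcNe yu ∷ y≢v ∷ y≢x ∷ []) ∷ (arcNe uv ∷ u≢x ∷ []) ∷ (arcNe vx ∷ []) ∷ [] ∷ [])
    (s≤s (s≤s (s≤s z≤n)))

  -- If x → u → v → a → x and y → u, then y → u → v → a → x is a return path
  -- with at most 3 colours: its last three arcs lie on a 4-cycle, which is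
  -- at most 2-coloured.  (Degenerate cases v = x or a = u give shorter ones.)
  noReturnAround4Cycle : ∀ {u v a} → Arc D x u → Arc D y u →
    Arc D u v → Arc D v a → Arc D a x → y ≢ v → y ≢ a → ⊥
  noReturnAround4Cycle {u} {v} {a} xu yu uv va ax y≢v y≢a
    with v Fin.≟ x | u Fin.≟ a
  ... | yes refl | _        = noReturn2 yu uv
  ... | no _     | yes refl = noReturn2 yu ax
  ... | no v≢x   | no u≢a   = noReturn (_ , colours≤3 , path , isPath , refl)
    where
    path : Walk D y x
    path = hop D u yu (hop D v uv (hop D a va (hop D x ax [])))
    u≢x : u ≢ x
    u≢x eq = arcNe xu (sym eq)
    isPath : IsPath D path
    isPath = (arcNe yu ∷ y≢v ∷ y≢a ∷ y≢x ∷ []) ∷ (arcNe uv ∷ u≢a ∷ u≢x ∷ [])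
           ∷ (arcNe va ∷ v≢x ∷ []) ∷ (arcNe ax ∷ []) ∷ [] ∷ []
    cycle≤2 : length (deduplicate Fin._≟_
                (colour x u ∷ colour u v ∷ colour v a ∷ colour a x ∷ [])) ≤ 2
    cycle≤2 = fourCycles x u v a
      ((arcNe xu ∷ (λ eq → v≢x (sym eq)) ∷ (λ eq → arcNe ax (sym eq)) ∷ [])
       ∷ (arcNe uv ∷ u≢a ∷ []) ∷ (arcNe va ∷ []) ∷ [] ∷ []) xu uv va ax
    colours≤3 : numColours D path ≤ 3
    colours≤3 = ≤-trans (distinct-replaceHead Fin._≟_ (colour y u) (colour x u)
                                              (colour u v ∷ colour v a ∷ colour a x ∷ []))
                        (s≤s cycle≤2)

  module SamePart (pxy : part x ≡ part y) (noTwoPath : ∀ z → Arc D x z → Arc D z y → ⊥) where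

    Dominated : Fin n → Set
    Dominated u = Arc D x u × Arc D y u

    outsideAdjacentX : ∀ {v} → part v ≢ part x → Arc D x v ⊎ Arc D v x
    outsideAdjacentX pv = adjacent x _ (λ eq → pv (sym eq))

    outsideAdjacentY : ∀ {v} → part v ≢ part x → Arc D y v ⊎ Arc D v y
    outsideAdjacentY pv = adjacent y _ (λ eq → pv (trans (sym eq) (sym pxy)))

    outsideNotY : ∀ {v} → part v ≢ part x → y ≢ v
    outsideNotY pv refl = pv (sym pxy)

    -- An out-neighbour of x outside x's part is dominated (else x → v → y).
    outNeighbourDominated : ∀ {v} → Arc D x v → part v ≢ part x → Dominated v
    outNeighbourDominated {v} xv pv with outsideAdjacentY pv
    ... | inj₁ yv = xv , yv
    ... | inj₂ vy = ⊥-elim (noTwoPath v xv vy)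

    leavesPart : ∀ {v a} → part v ≡ part x → Arc D v a → part a ≢ part x
    leavesPart pv va eq = arcPart va (trans pv (sym eq))

    -- A step out of the part of x from a dominated vertex stays dominated
    -- (else y → u → v → x is a short return path).
    outsideStep : ∀ {u v} → Dominated u → Arc D u v → part v ≢ part x → Dominated v
    outsideStep (xu , yu) uv pv with outsideAdjacentX pv
    ... | inj₁ xv = outNeighbourDominated xv pv
    ... | inj₂ vx = ⊥-elim (noReturn3 yu uv vx
                      (outsideNotY pv) (λ eq → arcNe xu (sym eq)))

    -- Two steps through the part of x from a dominated vertex reach a
    -- dominated vertex (else a return path around a 4-cycle).
    insideStep : ∀ {u v a} → Dominated u → Arc D u v → part v ≡ part x → v ≢ y →
                 Arc D v a → Dominated a
    insideStep (xu , yu) uv pv v≢y va with outsideAdjacentX (leavesPart pv va)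
    ... | inj₁ xa = outNeighbourDominated xa (leavesPart pv va)
    ... | inj₂ ax = ⊥-elim (noReturnAround4Cycle xu yu uv va ax (λ eq → v≢y (sym eq))
                      (outsideNotY (leavesPart pv va)))

    unreachable : ∀ {u} → Dominated u → Walk D u y → ⊥
    unreachable (_ , yu) [] = arcNe yu refl
    unreachable du (_∷_ {y = v} uv w) with part v Fin.≟ part x
    ... | no pv = unreachable (outsideStep du uv pv) w
    ... | yes pv with v Fin.≟ y
    ...   | yes refl = noTwoPath _ (proj₁ du) uv
    ...   | no v≢y with w
    ...     | []      = v≢y refl
    ...     | va ∷ w′ = unreachable (insideStep du uv pv v≢y va) w′

    noWalk : Walk D x y → ⊥
    noWalk []                  = x≢y refl
    noWalk (_∷_ {y = v} xv w) =
      unreachable (outNeighbourDominated xv (λ eq → arcPart xv (sym eq))) w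

  distanceAtMost2 : Walk D x y → DistLe D x y 2
  distanceAtMost2 w with part x Fin.≟ part y
  ... | no pxy with adjacent x y pxy
  ...   | inj₁ xy = hop D y xy [] , ((x≢y ∷ []) ∷ [] ∷ []) , s≤s z≤n
  ...   | inj₂ yx = ⊥-elim (noReturn1 yx)
  distanceAtMost2 w | yes pxy with Fin.any? (λ z → T? (arc x z) ×-dec T? (arc z y))
  ... | yes (z , xz , zy) = hop D z xz (hop D y zy []) ,
          ((arcNe xz ∷ x≢y ∷ []) ∷ (arcNe zy ∷ []) ∷ [] ∷ []) , s≤s (s≤s z≤n)
  ... | no noTwoPath = ⊥-elim (SamePart.noWalk pxy (λ z xz zy → noTwoPath (z , xz , zy)) w)

mainTheorem7 : (n m r : ℕ) → 3 ≤ r → (D : ColoredDigraph n m) →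
    (part : Fin n → Fin r) → IsSemicompleteMultipartite D r part →
    FourCyclesAtMost2Colored D →
    (x y : Fin n) →
    HasColoredPath D 3 x y →
    ¬ (Σ ℕ λ k' → k' ≤ 3 × HasColoredPath D k' y x) →
    DistLe D x y 2
mainTheorem7 n m r _ D part (_ , noSamePart , adjacent) fourCycles x y (w , _ , _) noReturn =
  Argument.distanceAtMost2 D part noSamePart adjacent fourCycles x y x≢y noReturn w
  where
  -- x = y would give the 0-coloured trivial return path.
  x≢y : x ≢ y
  x≢y refl = noReturn (0 , z≤n , [] , ([] ∷ []) , refl)
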